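{- Let $n \ge 3$ and let $S$ be a $4$-cap free, $n$-cup free configuration with a fixed slope labeling $s$ (values in $\{1,2\}$). For $p \in S$ let $\alpha(p)$ be the maximum size of a cup ending with $p$ whose last edge has label $1$ ($\alpha(p)=1$ if there is none), and let $\beta(p)$ be the maximum size of a cup ending with $p$. Then for any two distinct points $p, q \in S$: (i) if $\beta(p) = \beta(q)$, then the edge between $p$ and $q$ has label $1$, and $p < q$ if and only if $\alpha(p) < \alpha(q)$; (ii) if $\alpha(p) = \alpha(q)$, then the edge between $p$ and $q$ has label $2$, and $p < q$ if and only if $\beta(p) < \beta(q)$.
   Context: A configuration is a finite set $S$ with a linear order $<$, together with an arbitrary assignment, to each $3$-element subset, of "cap" or "cup". Points $x_1 < \cdots < x_m$ form an $m$-cup (resp. $m$-cap) if every consecutive triple $x_{i-1}x_ix_{i+1}$ is labeled cup (resp. cap); 1- and 2-element sets count as both; it ends with $x_m$ and (if $m\ge2$) its last edge is $x_{m-1}x_m$. An edge is a pair $x<y$ of points. A slope labeling of a $4$-cap free configuration $S$ is an assignment of $s(xy) \in \{1,2\}$ to every edge $xy$ such that for all $x<y<z$ in $S$, $s(xy) \leq s(yz)$ implies that $\{x,y,z\}$ is a cup. -}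

module Defs where

open import Data.Nat using (ℕ; zero; suc; _≤_; _<_)
open import Data.Fin using (Fin) renaming (_<_ to _<ᶠ_)
open import Data.Bool using (Bool; true; false)
open import Data.List using (List; []; _∷_; _++_; length)
open import Data.Product using (Σ; _×_; ∃; ∃-syntax)
open import Data.Unit using (⊤)
open import Data.Empty using (⊥)
open import Relation.Binary.PropositionalEquality using (_≡_)
open import Relation.Nullary using (¬_)

-- A configuration on N points: the point set is Fin N with its natural
-- linear order; `lab x y z` is the label of the 3-set {x,y,z} and is only
-- consulted when x < y < z.  true = "cup", false = "cap".
Labeling : ℕ → Set
Labeling N = Fin N → Fin N → Fin N → Bool

Increasing : {N : ℕ} → List (Fin N) → Set
Increasing [] = ⊤
Increasing (x ∷ []) = ⊤
Increasing (x ∷ y ∷ xs) = (x <ᶠ y) × Increasing (y ∷ xs)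

AllTriples : {N : ℕ} → Labeling N → Bool → List (Fin N) → Set
AllTriples lab b (x ∷ y ∷ z ∷ xs) = (lab x y z ≡ b) × AllTriples lab b (y ∷ z ∷ xs)
AllTriples lab b _ = ⊤

IsCup : {N : ℕ} → Labeling N → List (Fin N) → Set
IsCup lab xs = Increasing xs × AllTriples lab true xs

IsCap : {N : ℕ} → Labeling N → List (Fin N) → Set
IsCap lab xs = Increasing xs × AllTriples lab false xs

CapFree : {N : ℕ} → Labeling N → ℕ → Set
CapFree {N} lab m = (xs : List (Fin N)) → IsCap lab xs → ¬ (length xs ≡ m)

CupFree : {N : ℕ} → Labeling N → ℕ → Set
CupFree {N} lab m = (xs : List (Fin N)) → IsCup lab xs → ¬ (length xs ≡ m)

IsSlopeLabeling : {N : ℕ} → Labeling N → (Fin N → Fin N → ℕ) → Set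
IsSlopeLabeling {N} lab s =
  ((x y : Fin N) → x <ᶠ y → (s x y ≡ 1) Data.Sum.⊎ (s x y ≡ 2)) ×
  ((x y z : Fin N) → x <ᶠ y → y <ᶠ z → s x y ≤ s y z → lab x y z ≡ true)
  where import Data.Sum

CupEndingWith : {N : ℕ} → Labeling N → Fin N → List (Fin N) → Set
CupEndingWith {N} lab p xs = IsCup lab xs × Σ (List (Fin N)) (λ ys → xs ≡ ys ++ (p ∷ []))

CupEndingWithLabel1 : {N : ℕ} → Labeling N → (Fin N → Fin N → ℕ) → Fin N → List (Fin N) → Set
CupEndingWithLabel1 {N} lab s p xs =
  IsCup lab xs × Σ (List (Fin N)) (λ ys → Σ (Fin N) (λ x → (xs ≡ ys ++ (x ∷ p ∷ [])) × (s x p ≡ 1)))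

IsBeta : {N : ℕ} → Labeling N → Fin N → ℕ → Set
IsBeta {N} lab p b =
  (Σ (List (Fin N)) (λ xs → CupEndingWith lab p xs × (length xs ≡ b))) ×
  ((xs : List (Fin N)) → CupEndingWith lab p xs → length xs ≤ b)

IsAlpha : {N : ℕ} → Labeling N → (Fin N → Fin N → ℕ) → Fin N → ℕ → Set
IsAlpha {N} lab s p a =
  ((Σ (List (Fin N)) (λ xs → CupEndingWithLabel1 lab s p xs × (length xs ≡ a))) ×
   ((xs : List (Fin N)) → CupEndingWithLabel1 lab s p xs → length xs ≤ a))
  Data.Sum.⊎
  (((xs : List (Fin N)) → ¬ CupEndingWithLabel1 lab s p xs) × (a ≡ 1))
  where import Data.Sum

EdgeLabel : {N : ℕ} → (Fin N → Fin N → ℕ) → Fin N → Fin N → ℕ → Set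
EdgeLabel s p q c = (p <ᶠ q → s p q ≡ c) × (q <ᶠ p → s q p ≡ c)

-- Let p < q.  Every cup ending with p has a last edge of label at most 2, and
-- one of label 1 if it is counted by α; by the slope condition such a cup
-- extends by q whenever its last label is at most s(pq).  Hence an edge
-- labelled 2 strictly increases β and an edge labelled 1 strictly increases α.
-- If β(p) = β(q) the edge pq must therefore be labelled 1 and α increases
-- along it, and symmetrically when α(p) = α(q).
module Submission where

open import Defs
open import Data.Nat using (ℕ; suc; _≤_; _<_; s≤s; z≤n)
open import Data.Nat.Properties using (≤-refl; <-irrefl; +-comm)
  renaming (<-asym to <ℕ-asym)
open import Data.Fin using (Fin) renaming (_<_ to _<ᶠ_)
open import Data.Fin.Properties using (<-cmp; <-asym)
open import Data.Product using (_×_; _,_; proj₁; proj₂; ∃₂)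
open import Data.Sum using (_⊎_; inj₁; inj₂)
open import Data.List using (List; []; _∷_; _++_; _∷ʳ_; length; initLast; _∷ʳ′_)
open import Data.List.Properties using (++-assoc; length-++)
open import Data.Unit using (tt)
open import Data.Bool using (true)
open import Data.Empty using (⊥-elim)
open import Function.Bundles using (_⇔_; mk⇔)
open import Relation.Binary.PropositionalEquality using (_≡_; _≢_; refl; sym; trans; cong; subst; subst₂)
open import Relation.Binary.Definitions using (tri<; tri≈; tri>)
open import Relation.Nullary using (¬_)

length-∷ʳ : ∀ {A : Set} (xs : List A) (x : A) → length (xs ∷ʳ x) ≡ suc (length xs)
length-∷ʳ xs x = trans (length-++ xs) (+-comm (length xs) 1)

levelSet⇒edgeLabel×order : ∀ {N} (s : Fin N → Fin N → ℕ) (g f : Fin N → ℕ) (c : ℕ) →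
  (∀ {p q} → p <ᶠ q → g p ≡ g q → s p q ≡ c × f p < f q) →
  ∀ {p q} → p ≢ q → g p ≡ g q → EdgeLabel s p q c × ((p <ᶠ q) ⇔ (f p < f q))
levelSet⇒edgeLabel×order s g f c ordered {p} {q} p≢q gp≡gq with <-cmp p q
... | tri≈ _ p≡q _ = ⊥-elim (p≢q p≡q)
... | tri< p<q _ _ =
  let spq≡c , fp<fq = ordered p<q gp≡gq in
  ((λ _ → spq≡c) , (λ q<p → ⊥-elim (<-asym p<q q<p))) , mk⇔ (λ _ → fp<fq) (λ _ → p<q)
... | tri> _ _ q<p =
  let sqp≡c , fq<fp = ordered q<p (sym gp≡gq) in
  ((λ p<q → ⊥-elim (<-asym p<q q<p)) , (λ _ → sqp≡c)) ,
  mk⇔ (λ p<q → ⊥-elim (<-asym p<q q<p)) (λ fp<fq → ⊥-elim (<ℕ-asym fp<fq fq<fp))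

module _ {N : ℕ} (lab : Labeling N) where

  Increasing-lastEdge : ∀ zs {x p : Fin N} → Increasing (zs ++ x ∷ p ∷ []) → x <ᶠ p
  Increasing-lastEdge []           (x<p , _) = x<p
  Increasing-lastEdge (_ ∷ [])     (_ , inc) = Increasing-lastEdge [] inc
  Increasing-lastEdge (_ ∷ z ∷ zs) (_ , inc) = Increasing-lastEdge (z ∷ zs) inc

  IsCup-∷ʳ : ∀ zs {x p q : Fin N} → IsCup lab (zs ++ x ∷ p ∷ []) → p <ᶠ q → lab x p q ≡ true →
             IsCup lab ((zs ++ x ∷ p ∷ []) ∷ʳ q)
  IsCup-∷ʳ [] ((x<p , _) , _) p<q xpq = (x<p , p<q , tt) , xpq , tt
  IsCup-∷ʳ (_ ∷ []) ((a<x , x<p , _) , axp , _) p<q xpq =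
    (a<x , x<p , p<q , tt) , axp , xpq , tt
  IsCup-∷ʳ (_ ∷ _ ∷ []) ((a<b , b<x , x<p , _) , abx , bxp , _) p<q xpq =
    (a<b , b<x , x<p , p<q , tt) , abx , bxp , xpq , tt
  IsCup-∷ʳ (_ ∷ b ∷ c ∷ zs) ((a<b , inc) , abc , triples) p<q xpq
    with IsCup-∷ʳ (b ∷ c ∷ zs) (inc , triples) p<q xpq
  ... | inc′ , triples′ = (a<b , inc′) , abc , triples′

  CupEndingWith-view : ∀ {p : Fin N} {xs} → CupEndingWith lab p xs →
                       (xs ≡ p ∷ []) ⊎ ∃₂ λ zs x → xs ≡ zs ++ x ∷ p ∷ []
  CupEndingWith-view {p} (_ , ys , xs≡ys∷ʳp) with initLast ys
  ... | []        = inj₁ xs≡ys∷ʳp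
  ... | zs ∷ʳ′ x  = inj₂ (zs , x , trans xs≡ys∷ʳp (++-assoc zs (x ∷ []) (p ∷ [])))

  module _ (s : Fin N → Fin N → ℕ) (slope : IsSlopeLabeling lab s) where

    slope-≤2 : ∀ {x p} → x <ᶠ p → s x p ≤ 2
    slope-≤2 x<p with proj₁ slope _ _ x<p
    ... | inj₁ sxp≡1 = subst (_≤ 2) (sym sxp≡1) (s≤s z≤n)
    ... | inj₂ sxp≡2 = subst (_≤ 2) (sym sxp≡2) ≤-refl

    IsCup-extend : ∀ zs {x p q} → IsCup lab (zs ++ x ∷ p ∷ []) → p <ᶠ q → s x p ≤ s p q →
                   IsCup lab ((zs ++ x ∷ p ∷ []) ∷ʳ q)
    IsCup-extend zs cup p<q sxp≤spq =
      IsCup-∷ʳ zs cup p<q (proj₂ slope _ _ _ (Increasing-lastEdge zs (proj₁ cup)) p<q sxp≤spq)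

    module _ (α β : Fin N → ℕ)
             (isα : (p : Fin N) → IsAlpha lab s p (α p))
             (isβ : (p : Fin N) → IsBeta lab p (β p)) where

      β-step : ∀ {p q} → p <ᶠ q → s p q ≡ 2 → β p < β q
      β-step {p} {q} p<q spq≡2 with isβ p
      ... | (xs , cup , |xs|≡βp) , _ =
        subst (_≤ β q) (cong suc |xs|≡βp) (longer (CupEndingWith-view cup))
        where
          longer : (xs ≡ p ∷ []) ⊎ ∃₂ (λ zs x → xs ≡ zs ++ x ∷ p ∷ []) → suc (length xs) ≤ β q
          longer (inj₁ refl) = proj₂ (isβ q) (p ∷ q ∷ []) (((p<q , tt) , tt) , p ∷ [] , refl)
          longer (inj₂ (zs , x , refl)) =
            subst (_≤ β q) (length-∷ʳ xs q)
              (proj₂ (isβ q) (xs ∷ʳ q) (extended , xs , refl))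
            where
              extended : IsCup lab (xs ∷ʳ q)
              extended = IsCup-extend zs (proj₁ cup) p<q
                (subst (s x p ≤_) (sym spq≡2) (slope-≤2 (Increasing-lastEdge zs (proj₁ (proj₁ cup)))))

      α-step : ∀ {p q} → p <ᶠ q → s p q ≡ 1 → α p < α q
      α-step {p} {q} p<q spq≡1 = bound (isα q) witness
        where
          witness : ∃₂ λ xs (_ : CupEndingWithLabel1 lab s q xs) → length xs ≡ suc (α p)
          witness with isα p
          ... | inj₂ (_ , αp≡1) =
            p ∷ q ∷ [] , (((p<q , tt) , tt) , [] , p , refl , spq≡1) , cong suc (sym αp≡1)
          ... | inj₁ ((_ , (cup , zs , x , refl , sxp≡1) , |xs|≡αp) , _) =
            (zs ++ x ∷ p ∷ []) ∷ʳ q ,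
            (IsCup-extend zs cup p<q (subst₂ _≤_ (sym sxp≡1) (sym spq≡1) ≤-refl) ,
             zs ∷ʳ x , p , regroup , spq≡1) ,
            trans (length-∷ʳ (zs ++ x ∷ p ∷ []) q) (cong suc |xs|≡αp)
            where
              regroup : (zs ++ x ∷ p ∷ []) ∷ʳ q ≡ (zs ∷ʳ x) ++ p ∷ q ∷ []
              regroup = trans (++-assoc zs (x ∷ p ∷ []) (q ∷ [])) (sym (++-assoc zs (x ∷ []) (p ∷ q ∷ [])))
          bound : IsAlpha lab s q (α q) → ∃₂ (λ xs (_ : CupEndingWithLabel1 lab s q xs) → length xs ≡ suc (α p)) →
                  α p < α q
          bound (inj₁ (_ , maximal)) (xs , cup , |xs|≡) = subst (_≤ α q) |xs|≡ (maximal xs cup)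
          bound (inj₂ (none , _))    (xs , cup , _)     = ⊥-elim (none xs cup)

      β≡⇒label1 : ∀ {p q} → p <ᶠ q → β p ≡ β q → s p q ≡ 1 × α p < α q
      β≡⇒label1 p<q βp≡βq with proj₁ slope _ _ p<q
      ... | inj₁ spq≡1 = spq≡1 , α-step p<q spq≡1
      ... | inj₂ spq≡2 = ⊥-elim (<-irrefl βp≡βq (β-step p<q spq≡2))

      α≡⇒label2 : ∀ {p q} → p <ᶠ q → α p ≡ α q → s p q ≡ 2 × β p < β q
      α≡⇒label2 p<q αp≡αq with proj₁ slope _ _ p<q
      ... | inj₁ spq≡1 = ⊥-elim (<-irrefl αp≡αq (α-step p<q spq≡1))
      ... | inj₂ spq≡2 = spq≡2 , β-step p<q spq≡2

corollary4p3 : (n N : ℕ) → 3 ≤ n → (lab : Labeling N) → CapFree lab 4 → CupFree lab n →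
    (s : Fin N → Fin N → ℕ) → IsSlopeLabeling lab s →
    (α β : Fin N → ℕ) → ((p : Fin N) → IsAlpha lab s p (α p)) → ((p : Fin N) → IsBeta lab p (β p)) →
    (p q : Fin N) → ¬ (p ≡ q) →
    ((β p ≡ β q → EdgeLabel s p q 1 × ((p <ᶠ q) ⇔ (α p < α q))) ×
     (α p ≡ α q → EdgeLabel s p q 2 × ((p <ᶠ q) ⇔ (β p < β q))))
corollary4p3 _ _ _ lab _ _ s slope α β isα isβ p q p≢q =
  levelSet⇒edgeLabel×order s β α 1 (β≡⇒label1 lab s slope α β isα isβ) p≢q ,
  levelSet⇒edgeLabel×order s α β 2 (α≡⇒label2 lab s slope α β isα isβ) p≢q
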